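{- For every positive integer $n$, $$\Phi^{(3)}[a, a'; bq^n, b'; c; x, y] = \sum_{k=0}^n \begin{bmatrix} n \\ k \end{bmatrix} q^{2\binom{k}{2}} \frac{(bx)^k (a; q)_k}{(c; q)_k} \Phi^{(3)}[aq^k, a'; bq^k, b'; cq^k; x, y],$$ and $$\Phi^{(3)}[a, a'; bq^{ -n}, b'; c; x, y] = \sum_{k=0}^n \begin{bmatrix} n \\ k \end{bmatrix} q^{\binom{k}{2} - nk} \frac{(-bx)^k (a; q)_k}{(c; q)_k} \Phi^{(3)}[aq^k, a'; b, b'; cq^k; x, y].$$
   Context: Let $q$ be a complex number with $|q|<1$. For a complex number $z$ and an integer $N\ge 0$, $(z;q)_N=\prod_{j=0}^{N-1}(1-zq^j)$. The $q$-binomial coefficient is $\begin{bmatrix} n \\ k \end{bmatrix}=\frac{(q;q)_n}{(q;q)_k(q;q)_{n-k}}$ for $0\le k\le n$, and $\binom{k}{2}=k(k-1)/2$. The $q$-Appell function $\Phi^{(3)}$ is $$\Phi^{(3)}[a, a'; b, b'; c; x, y] = \sum_{m, n \geq 0} \frac{(a; q)_m (a'; q)_n (b; q)_m (b'; q)_n}{(q; q)_m (q; q)_n (c; q)_{m+n}} x^m y^n .$$ All identities are understood as identities of power series in $x,y$ (convergent for $|x|,|y|$ sufficiently small), with parameters generic so that no denominator appearing vanishes. -}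

module Defs where

open import Level using (Level; _⊔_) renaming (suc to lsuc)
open import Algebra.Bundles using (CommutativeRing)
open import Data.Nat using (ℕ; zero; suc; _∸_) renaming (_+_ to _+ℕ_)
open import Relation.Nullary using (¬_)

-- A field, given as a commutative ring with a (total) inverse function that is a
-- genuine inverse on every nonzero element, and 0 ≠ 1.
record Field (c ℓ : Level) : Set (lsuc (c ⊔ ℓ)) where
  field
    commutativeRing : CommutativeRing c ℓ
  open CommutativeRing commutativeRing public
  field
    inv      : Carrier → Carrier
    inverseʳ : ∀ x → ¬ (x ≈ 0#) → x * inv x ≈ 1#
    0≉1      : ¬ (0# ≈ 1#)

module FieldDefs {c ℓ : Level} (F : Field c ℓ) where
  open Field F using (Carrier; _≈_; _+_; _*_; -_; _-_; 0#; 1#; inv)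

  pow : Carrier → ℕ → Carrier
  pow z zero    = 1#
  pow z (suc k) = pow z k * z

  _÷_ : Carrier → Carrier → Carrier
  x ÷ y = x * inv y

  poch : (q z : Carrier) → ℕ → Carrier
  poch q z zero    = 1#
  poch q z (suc N) = poch q z N * (1# - z * pow q N)

  -- q-binomial coefficient [n k] = (q;q)_n / ((q;q)_k (q;q)_{n-k})  (used for 0 ≤ k ≤ n)
  qbinom : (q : Carrier) → ℕ → ℕ → Carrier
  qbinom q n k = poch q q n ÷ (poch q q k * poch q q (n ∸ k))

  -- formal power series in two variables x, y: coefficient of x^m y^p
  Series : Set c
  Series = ℕ → ℕ → Carrier

  Φ3 : (q a a' b b' γ : Carrier) → Series
  Φ3 q a a' b b' γ m p =
    (poch q a m * poch q a' p * poch q b m * poch q b' p)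
      ÷ (poch q q m * poch q q p * poch q γ (m +ℕ p))

  mulX : Series → Series
  mulX s zero    p = 0#
  mulX s (suc m) p = s m p

  mulXPow : ℕ → Series → Series
  mulXPow zero    s = s
  mulXPow (suc k) s = mulX (mulXPow k s)

  scale : Carrier → Series → Series
  scale r s m p = r * s m p

  sumTo : ℕ → (ℕ → Series) → Series
  sumTo zero    f m p = f zero m p
  sumTo (suc n) f m p = sumTo n f m p + f (suc n) m p

  _≋_ : Series → Series → Set ℓ
  s ≋ t = ∀ m p → s m p ≈ t m p

module Submission where

-- Both identities are equalities of formal power series, checked coefficient
-- by coefficient.  Each right-hand side has the shape
--   Σ_{k≤n} R_k B_k (a;q)_k/(γ;q)_k x^k Φ3[aq^k, a'; βₖ, b'; γq^k; x, y].
-- After clearing the nonzero denominator (q;q)_m (q;q)_p (γ;q)_{m+p}, the k-th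
-- summand contributes (a;q)_m (a';q)_p (b';q)_p · R_k B_k · T(βₖ,k,m) to the
-- coefficient of x^m y^p, where T(β,k,m) = (β;q)_{m-k} (q^{m-k+1};q)_k is a
-- truncated Pochhammer symbol (zero for m < k).  So each identity reduces to
-- an expansion of one Pochhammer symbol in the basis T(·,k,m) (Φ3-expand):
--
--   (b q^n;q)_m  = Σ_k [n k] q^{2(k choose 2)} b^k  T(b q^k, k, m)
--   (b q^-n;q)_m = Σ_k [n k] q^{(k choose 2) - nk} (-b)^k T(b, k, m).
--
-- These follow by induction on n from the three-term recurrence of T
-- (trunc-step) and the q-Pascal rule for Gaussian polynomials
-- (gauss-pascal-sum), after identifying the statement's q-binomial
-- coefficient with the Gaussian polynomial (qbinom≈gauss).

open import Defs
open import Level using (Level)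
open import Data.Nat using (ℕ; _≤_) renaming (_*_ to _*ℕ_)
open import Data.Nat.Combinatorics using (_C_)
open import Data.Product using (_×_)
open import Relation.Nullary using (¬_)

open import Data.Nat using (zero; suc; _<_; z≤n; s≤s; _∸_) renaming (_+_ to _+ℕ_)
import Data.Nat.Properties as ℕP
open import Data.Nat.Combinatorics using (nC1≡n; nCk+nC[k+1]≡[n+1]C[k+1])
open import Data.Nat.Tactic.RingSolver using (solve-∀)
open import Data.Integer as ℤ using (ℤ; +_; -[1+_]; _⊖_)
import Data.Integer.Properties as ℤP
import Data.Sign as Sign
open import Data.Maybe using (Maybe; just; nothing)
open import Data.Product using (_,_)
open import Relation.Nullary using (yes; no)
open import Relation.Binary.PropositionalEquality as ≡ using (_≡_)
open import Algebra.Bundles using (CommutativeRing)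
open import Algebra.Solver.Ring.AlmostCommutativeRing
  using (fromCommutativeRing; _-Raw-AlmostCommutative⟶_)

-- The ring solver for an arbitrary commutative ring, with integer
-- coefficients interpreted through the canonical ring map ℤ → R.
module IntegerSolver {c ℓ : Level} (CR : CommutativeRing c ℓ) where
  open CommutativeRing CR
  open import Algebra.Properties.Semiring.Mult.TCOptimised semiring renaming (_×_ to _⋆_)
  open import Algebra.Properties.Ring ring
  open import Relation.Binary.Reasoning.Setoid setoid

  ⟦_⟧ℤ : ℤ → Carrier
  ⟦ + n ⟧ℤ      = n ⋆ 1#
  ⟦ -[1+ n ] ⟧ℤ = - (suc n ⋆ 1#)

  shift-difference : ∀ a b → a - b ≈ (1# + a) - (1# + b)
  shift-difference a b = begin
    a - b                    ≈⟨ +-identityˡ _ ⟨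
    0# + (a - b)             ≈⟨ +-congʳ (-‿inverseʳ 1#) ⟨
    (1# - 1#) + (a - b)      ≈⟨ +-assoc 1# (- 1#) (a - b) ⟩
    1# + (- 1# + (a - b))    ≈⟨ +-congˡ (+-assoc (- 1#) a (- b)) ⟨
    1# + ((- 1# + a) - b)    ≈⟨ +-congˡ (+-congʳ (+-comm (- 1#) a)) ⟩
    1# + ((a - 1#) - b)      ≈⟨ +-congˡ (+-assoc a (- 1#) (- b)) ⟩
    1# + (a + (- 1# - b))    ≈⟨ +-assoc 1# a _ ⟨
    (1# + a) + (- 1# - b)    ≈⟨ +-congˡ (-‿+-comm 1# b) ⟩
    (1# + a) - (1# + b)      ∎

  ⊖-homo : ∀ m n → ⟦ m ⊖ n ⟧ℤ ≈ m ⋆ 1# - n ⋆ 1#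
  ⊖-homo m zero = begin
    m ⋆ 1#       ≈⟨ +-identityʳ _ ⟨
    m ⋆ 1# + 0#  ≈⟨ +-congˡ -0#≈0# ⟨
    m ⋆ 1# - 0#  ∎
  ⊖-homo zero (suc n) = sym (+-identityˡ _)
  ⊖-homo (suc m) (suc n) = begin
    ⟦ suc m ⊖ suc n ⟧ℤ             ≡⟨ ≡.cong ⟦_⟧ℤ (ℤP.[1+m]⊖[1+n]≡m⊖n m n) ⟩
    ⟦ m ⊖ n ⟧ℤ                     ≈⟨ ⊖-homo m n ⟩
    m ⋆ 1# - n ⋆ 1#                ≈⟨ shift-difference (m ⋆ 1#) (n ⋆ 1#) ⟩
    (1# + m ⋆ 1#) - (1# + n ⋆ 1#)  ≈⟨ +-cong (sym (1+× m 1#)) (-‿cong (sym (1+× n 1#))) ⟩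
    suc m ⋆ 1# - suc n ⋆ 1#        ∎

  +-homo : ∀ i j → ⟦ i ℤ.+ j ⟧ℤ ≈ ⟦ i ⟧ℤ + ⟦ j ⟧ℤ
  +-homo -[1+ m ] -[1+ n ] = begin
    - (suc (suc (m +ℕ n)) ⋆ 1#)    ≡⟨ ≡.cong (λ k → - (suc k ⋆ 1#)) (≡.sym (ℕP.+-suc m n)) ⟩
    - ((suc m +ℕ suc n) ⋆ 1#)      ≈⟨ -‿cong (×-homo-+ 1# (suc m) (suc n)) ⟩
    - (suc m ⋆ 1# + suc n ⋆ 1#)    ≈⟨ -‿+-comm _ _ ⟨
    - (suc m ⋆ 1#) - (suc n ⋆ 1#)  ∎
  +-homo -[1+ m ] (+ n) = trans (⊖-homo n (suc m)) (+-comm _ _)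
  +-homo (+ m) -[1+ n ] = ⊖-homo m (suc n)
  +-homo (+ m) (+ n)    = ×-homo-+ 1# m n

  neg-homo : ∀ i → ⟦ ℤ.- i ⟧ℤ ≈ - ⟦ i ⟧ℤ
  neg-homo -[1+ n ]  = sym (-‿involutive _)
  neg-homo (+ zero)  = sym -0#≈0#
  neg-homo (+ suc n) = refl

  -- sign-magnitude forms, as produced by integer multiplication
  ◃-positive : ∀ n → ⟦ Sign.+ ℤ.◃ n ⟧ℤ ≈ n ⋆ 1#
  ◃-positive zero    = refl
  ◃-positive (suc n) = refl

  ◃-negative : ∀ n → ⟦ Sign.- ℤ.◃ n ⟧ℤ ≈ - (n ⋆ 1#)
  ◃-negative zero    = sym -0#≈0#
  ◃-negative (suc n) = refl

  -‿*-cancel : ∀ x y → - x * - y ≈ x * y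
  -‿*-cancel x y = trans (sym (-‿distribˡ-* x (- y)))
                         (trans (-‿cong (sym (-‿distribʳ-* x y))) (-‿involutive _))

  *-homo : ∀ i j → ⟦ i ℤ.* j ⟧ℤ ≈ ⟦ i ⟧ℤ * ⟦ j ⟧ℤ
  *-homo (+ m) (+ n) = trans (◃-positive (m *ℕ n)) (×1-homo-* m n)
  *-homo (+ m) -[1+ n ] =
    trans (◃-negative (m *ℕ suc n)) (trans (-‿cong (×1-homo-* m (suc n))) (-‿distribʳ-* _ _))
  *-homo -[1+ m ] (+ n) =
    trans (◃-negative (suc m *ℕ n)) (trans (-‿cong (×1-homo-* (suc m) n)) (-‿distribˡ-* _ _))
  *-homo -[1+ m ] -[1+ n ] =
    trans (◃-positive (suc m *ℕ suc n)) (trans (×1-homo-* (suc m) (suc n)) (sym (-‿*-cancel _ _)))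

  ℤ-homomorphism : ℤ.+-*-rawRing -Raw-AlmostCommutative⟶ fromCommutativeRing CR
  ℤ-homomorphism = record
    { ⟦_⟧ = ⟦_⟧ℤ ; +-homo = +-homo ; *-homo = *-homo ; -‿homo = neg-homo
    ; 0-homo = refl ; 1-homo = refl }

  ℤ-equal? : ∀ i j → Maybe (⟦ i ⟧ℤ ≈ ⟦ j ⟧ℤ)
  ℤ-equal? i j with i ℤ.≟ j
  ... | yes ≡.refl = just refl
  ... | no _       = nothing

  open import Algebra.Solver.Ring ℤ.+-*-rawRing (fromCommutativeRing CR) ℤ-homomorphism ℤ-equal? public

  𝟘 𝟙 : ∀ {n} → Polynomial n
  𝟘 = con (+ 0)
  𝟙 = con (+ 1)

C2-suc : ∀ k → suc k C 2 ≡ k +ℕ k C 2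
C2-suc k = ≡.trans (≡.sym (nCk+nC[k+1]≡[n+1]C[k+1] k 1)) (≡.cong (_+ℕ k C 2) (nC1≡n k))

double-C2-suc : ∀ k → 2 *ℕ (suc k C 2) ≡ k +ℕ (k +ℕ 2 *ℕ (k C 2))
double-C2-suc k = ≡.trans (≡.cong (2 *ℕ_) (C2-suc k)) (distribute k (k C 2))
  where
  distribute : ∀ u v → 2 *ℕ (u +ℕ v) ≡ u +ℕ (u +ℕ 2 *ℕ v)
  distribute = solve-∀

data Split (k : ℕ) : ℕ → Set where
  below : ∀ {m} → m < k → Split k m
  above : ∀ j → Split k (k +ℕ j)

split : ∀ k m → Split k m
split zero    m    = above m
split (suc k) zero = below (s≤s z≤n)
split (suc k) (suc m) with split k m
... | below m<k = below (s≤s m<k)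
... | above j   = above j

-- q-calculus over a field F with base q.  Everything up to qbinom≈gauss is
-- pure commutative-ring algebra; the field structure is used only to clear
-- denominators.
module QCalculus {c ℓ : Level} (F : Field c ℓ) (q : Field.Carrier F) where
  open Field F hiding (zero)
  open FieldDefs F
  open IntegerSolver commutativeRing
  open import Relation.Binary.Reasoning.Setoid setoid

  Σ≤ : ℕ → (ℕ → Carrier) → Carrier
  Σ≤ zero    f = f zero
  Σ≤ (suc n) f = Σ≤ n f + f (suc n)

  sumTo-Σ≤ : ∀ n (f : ℕ → Series) m p → sumTo n f m p ≡ Σ≤ n (λ k → f k m p)
  sumTo-Σ≤ zero    f m p = ≡.refl
  sumTo-Σ≤ (suc n) f m p = ≡.cong (_+ f (suc n) m p) (sumTo-Σ≤ n f m p)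

  Σ≤-cong : ∀ n {f g : ℕ → Carrier} → (∀ k → k ≤ n → f k ≈ g k) → Σ≤ n f ≈ Σ≤ n g
  Σ≤-cong zero    f≈g = f≈g 0 z≤n
  Σ≤-cong (suc n) f≈g =
    +-cong (Σ≤-cong n (λ k k≤n → f≈g k (ℕP.m≤n⇒m≤1+n k≤n))) (f≈g (suc n) ℕP.≤-refl)

  Σ≤-+ : ∀ n (f g : ℕ → Carrier) → Σ≤ n (λ k → f k + g k) ≈ Σ≤ n f + Σ≤ n g
  Σ≤-+ zero    f g = refl
  Σ≤-+ (suc n) f g = trans (+-congʳ (Σ≤-+ n f g))
    (solve 4 (λ a b x y → (a :+ b) :+ (x :+ y) := (a :+ x) :+ (b :+ y)) refl _ _ _ _)

  Σ≤-*ˡ : ∀ n r (f : ℕ → Carrier) → r * Σ≤ n f ≈ Σ≤ n (λ k → r * f k)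
  Σ≤-*ˡ zero    r f = refl
  Σ≤-*ˡ (suc n) r f = trans (distribˡ r _ _) (+-congʳ (Σ≤-*ˡ n r f))

  Σ≤-*ʳ : ∀ n r (f : ℕ → Carrier) → Σ≤ n f * r ≈ Σ≤ n (λ k → f k * r)
  Σ≤-*ʳ zero    r f = refl
  Σ≤-*ʳ (suc n) r f = trans (distribʳ r _ _) (+-congʳ (Σ≤-*ʳ n r f))

  Σ≤-peel : ∀ n (f : ℕ → Carrier) → Σ≤ (suc n) f ≈ f 0 + Σ≤ n (λ k → f (suc k))
  Σ≤-peel zero    f = refl
  Σ≤-peel (suc n) f = trans (+-congʳ (Σ≤-peel n f)) (+-assoc _ _ _)

  Σ≤-recombine : ∀ n (A B T : ℕ → Carrier) →
    T 0 ≈ A 0 → (∀ k → T (suc k) ≈ A (suc k) + B k) → A (suc n) ≈ 0# →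
    Σ≤ n (λ k → A k + B k) ≈ Σ≤ (suc n) T
  Σ≤-recombine n A B T T₀ Tₛ Aₙ₊₁ = begin
    Σ≤ n (λ k → A k + B k)                        ≈⟨ Σ≤-+ n A B ⟩
    Σ≤ n A + Σ≤ n B                               ≈⟨ +-congʳ (trans (sym (+-identityʳ _)) (+-congˡ (sym Aₙ₊₁))) ⟩
    Σ≤ (suc n) A + Σ≤ n B                         ≈⟨ +-congʳ (Σ≤-peel n A) ⟩
    (A 0 + Σ≤ n (λ k → A (suc k))) + Σ≤ n B       ≈⟨ +-assoc _ _ _ ⟩
    A 0 + (Σ≤ n (λ k → A (suc k)) + Σ≤ n B)       ≈⟨ +-cong (sym T₀) (sym (Σ≤-+ n _ _)) ⟩
    T 0 + Σ≤ n (λ k → A (suc k) + B k)            ≈⟨ +-congˡ (Σ≤-cong n (λ k _ → sym (Tₛ k))) ⟩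
    T 0 + Σ≤ n (λ k → T (suc k))                  ≈⟨ Σ≤-peel n T ⟨
    Σ≤ (suc n) T                                  ∎

  pow-cong : ∀ {x y} k → x ≈ y → pow x k ≈ pow y k
  pow-cong zero    x≈y = refl
  pow-cong (suc k) x≈y = *-cong (pow-cong k x≈y) x≈y

  pow-+ : ∀ z i j → pow z (i +ℕ j) ≈ pow z i * pow z j
  pow-+ z zero    j = sym (*-identityˡ _)
  pow-+ z (suc i) j = trans (*-congʳ (pow-+ z i j))
    (solve 3 (λ a b x → (a :* b) :* x := (a :* x) :* b) refl _ _ _)

  pow-* : ∀ x y k → pow (x * y) k ≈ pow x k * pow y k
  pow-* x y zero    = sym (*-identityˡ _)
  pow-* x y (suc k) = trans (*-congʳ (pow-* x y k))
    (solve 4 (λ a b x y → (a :* b) :* (x :* y) := (a :* x) :* (b :* y)) refl _ _ _ _)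

  pow-1 : ∀ k → pow 1# k ≈ 1#
  pow-1 zero    = refl
  pow-1 (suc k) = trans (*-identityʳ _) (pow-1 k)

  pow-pow : ∀ z n k → pow z (n *ℕ k) ≈ pow (pow z n) k
  pow-pow z zero    k = sym (pow-1 k)
  pow-pow z (suc n) k = begin
    pow z (k +ℕ n *ℕ k)        ≈⟨ pow-+ z k (n *ℕ k) ⟩
    pow z k * pow z (n *ℕ k)   ≈⟨ *-congˡ (pow-pow z n k) ⟩
    pow z k * pow (pow z n) k  ≈⟨ *-comm _ _ ⟩
    pow (pow z n) k * pow z k  ≈⟨ pow-* (pow z n) z k ⟨
    pow (pow z n * z) k        ∎

  poch-cong : ∀ {x y} m → x ≈ y → poch q x m ≈ poch q y m
  poch-cong zero    x≈y = refl
  poch-cong (suc m) x≈y = *-cong (poch-cong m x≈y) (+-congˡ (-‿cong (*-congʳ x≈y)))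

  poch-unfold : ∀ x m → poch q x (suc m) ≈ (1# - x) * poch q (x * q) m
  poch-unfold x zero    = solve 1 (λ x → 𝟙 :* (𝟙 :- x :* 𝟙) := (𝟙 :- x) :* 𝟙) refl x
  poch-unfold x (suc m) = trans (*-congʳ (poch-unfold x m))
    (solve 4 (λ x P Q q → ((𝟙 :- x) :* P) :* (𝟙 :- x :* (Q :* q)) := (𝟙 :- x) :* (P :* (𝟙 :- (x :* q) :* Q)))
           refl x _ (pow q m) q)

  poch-+ : ∀ x k j → poch q x (k +ℕ j) ≈ poch q x k * poch q (x * pow q k) j
  poch-+ x k zero = trans (≡.subst (λ t → poch q x (k +ℕ 0) ≈ poch q x t) (ℕP.+-identityʳ k) refl)
                          (sym (*-identityʳ _))
  poch-+ x k (suc j) = begin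
    poch q x (k +ℕ suc j)                                                 ≡⟨ ≡.cong (poch q x) (ℕP.+-suc k j) ⟩
    poch q x (k +ℕ j) * (1# - x * pow q (k +ℕ j))                         ≈⟨ *-cong (poch-+ x k j) (+-congˡ (-‿cong (*-congˡ (pow-+ q k j)))) ⟩
    poch q x k * poch q (x * pow q k) j * (1# - x * (pow q k * pow q j))  ≈⟨ solve 5 (λ A B x a b → A :* B :* (𝟙 :- x :* (a :* b)) := A :* (B :* (𝟙 :- x :* a :* b))) refl _ _ x _ _ ⟩
    poch q x k * poch q (x * pow q k) (suc j)                             ∎

  qfac : ℕ → Carrier
  qfac = poch q q

  qfac-+ : ∀ k j → qfac (k +ℕ j) ≈ qfac j * poch q (q * pow q j) k
  qfac-+ k j = ≡.subst (λ t → qfac t ≈ qfac j * poch q (q * pow q j) k) (ℕP.+-comm j k) (poch-+ q j k)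

  -- truncated Pochhammer symbol: trunc x k m = (x;q)_{m-k} (q^{m-k+1};q)_k,
  -- and 0 when m < k
  trunc : Carrier → ℕ → ℕ → Carrier
  trunc x zero    m       = poch q x m
  trunc x (suc k) zero    = 0#
  trunc x (suc k) (suc m) = trunc x k m * (1# - q * pow q m)

  trunc-cong : ∀ {x y} k m → x ≈ y → trunc x k m ≈ trunc y k m
  trunc-cong zero    m       x≈y = poch-cong m x≈y
  trunc-cong (suc k) zero    x≈y = refl
  trunc-cong (suc k) (suc m) x≈y = *-congʳ (trunc-cong k m x≈y)

  trunc-below : ∀ x k m → m < k → trunc x k m ≈ 0#
  trunc-below x (suc k) zero    m<k       = refl
  trunc-below x (suc k) (suc m) (s≤s m<k) = trans (*-congʳ (trunc-below x k m m<k)) (zeroˡ _)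

  trunc-above : ∀ x k j → trunc x k (k +ℕ j) ≈ poch q x j * poch q (q * pow q j) k
  trunc-above x zero    j = sym (*-identityʳ _)
  trunc-above x (suc k) j = begin
    trunc x k (k +ℕ j) * (1# - q * pow q (k +ℕ j))                  ≈⟨ *-cong (trunc-above x k j) (+-congˡ (-‿cong (*-congˡ (pow-+ q k j)))) ⟩
    poch q x j * poch q (q * pow q j) k * (1# - q * (pow q k * pow q j))
      ≈⟨ solve 5 (λ A B q a b → A :* B :* (𝟙 :- q :* (a :* b)) := A :* (B :* (𝟙 :- q :* b :* a))) refl _ _ q _ _ ⟩
    poch q x j * poch q (q * pow q j) (suc k)                      ∎

  trunc-step : ∀ x k m → trunc (x * q) k m ≈ trunc x k m + x * trunc (x * q) (suc k) m
  trunc-step x zero zero = solve 1 (λ x → 𝟙 := 𝟙 :+ x :* 𝟘) refl x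
  trunc-step x zero (suc m) = begin
    poch q (x * q) m * (1# - x * q * pow q m)
      ≈⟨ solve 4 (λ P x q Q → P :* (𝟙 :- x :* q :* Q) := (𝟙 :- x) :* P :+ x :* (P :* (𝟙 :- q :* Q))) refl _ x q _ ⟩
    (1# - x) * poch q (x * q) m + x * (poch q (x * q) m * (1# - q * pow q m))  ≈⟨ +-congʳ (poch-unfold x m) ⟨
    poch q x (suc m) + x * trunc (x * q) 1 (suc m)                             ∎
  trunc-step x (suc k) zero = solve 1 (λ x → 𝟘 := 𝟘 :+ x :* 𝟘) refl x
  trunc-step x (suc k) (suc m) = trans (*-congʳ (trunc-step x k m))
    (solve 4 (λ A x B u → (A :+ x :* B) :* u := A :* u :+ x :* (B :* u)) refl _ x _ _)

  gauss : ℕ → ℕ → Carrier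
  gauss zero    zero    = 1#
  gauss zero    (suc k) = 0#
  gauss (suc n) zero    = 1#
  gauss (suc n) (suc k) = pow q (suc k) * gauss n (suc k) + gauss n k

  gauss-0 : ∀ n → gauss n 0 ≈ 1#
  gauss-0 zero    = refl
  gauss-0 (suc n) = refl

  gauss-above : ∀ n k → n < k → gauss n k ≈ 0#
  gauss-above zero    (suc k) n<k       = refl
  gauss-above (suc n) (suc k) (s≤s n<k) = begin
    pow q (suc k) * gauss n (suc k) + gauss n k
      ≈⟨ +-cong (*-congˡ (gauss-above n (suc k) (ℕP.m<n⇒m<1+n n<k))) (gauss-above n k n<k) ⟩
    pow q (suc k) * 0# + 0#  ≈⟨ solve 1 (λ a → a :* 𝟘 :+ 𝟘 := 𝟘) refl _ ⟩
    0#                       ∎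

  gauss-diag : ∀ n → gauss n n ≈ 1#
  gauss-diag zero    = refl
  gauss-diag (suc n) = trans (+-cong (*-congˡ (gauss-above n (suc n) ℕP.≤-refl)) (gauss-diag n))
    (solve 1 (λ a → a :* 𝟘 :+ 𝟙 := 𝟙) refl _)

  gauss-qfac : ∀ k d → gauss (k +ℕ d) k * (qfac k * qfac d) ≈ qfac (k +ℕ d)
  gauss-qfac zero d = trans (*-congʳ (gauss-0 d)) (solve 1 (λ x → 𝟙 :* (𝟙 :* x) := x) refl _)
  gauss-qfac (suc k) zero = begin
    gauss (suc k +ℕ 0) (suc k) * (qfac (suc k) * 1#)  ≡⟨ ≡.cong (λ t → gauss t (suc k) * (qfac (suc k) * 1#)) (ℕP.+-identityʳ (suc k)) ⟩
    gauss (suc k) (suc k) * (qfac (suc k) * 1#)       ≈⟨ *-congʳ (gauss-diag (suc k)) ⟩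
    1# * (qfac (suc k) * 1#)                          ≈⟨ solve 1 (λ x → 𝟙 :* (x :* 𝟙) := x) refl _ ⟩
    qfac (suc k)                                      ≡⟨ ≡.cong qfac (ℕP.+-identityʳ (suc k)) ⟨
    qfac (suc k +ℕ 0)                                 ∎
  gauss-qfac (suc k) (suc d) = begin
    (pow q k * q * X + Y) * (qfac k * (1# - q * pow q k) * (qfac d * (1# - q * pow q d)))
      ≈⟨ solve 7 (λ X Y Qk Qd a Pk Pd →
            (Pk :* a :* X :+ Y) :* (Qk :* (𝟙 :- a :* Pk) :* (Qd :* (𝟙 :- a :* Pd)))
            := (𝟙 :- a :* Pd) :* Pk :* a :* (X :* (Qk :* (𝟙 :- a :* Pk) :* Qd))
               :+ (𝟙 :- a :* Pk) :* (Y :* (Qk :* (Qd :* (𝟙 :- a :* Pd)))))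
            refl X Y (qfac k) (qfac d) q (pow q k) (pow q d) ⟩
    (1# - q * pow q d) * pow q k * q * (X * (qfac k * (1# - q * pow q k) * qfac d))
      + (1# - q * pow q k) * (Y * (qfac k * (qfac d * (1# - q * pow q d))))
      ≈⟨ +-cong (*-congˡ X-identity) (*-congˡ (gauss-qfac k (suc d))) ⟩
    (1# - q * pow q d) * pow q k * q * qfac N + (1# - q * pow q k) * qfac N
      ≈⟨ solve 4 (λ a Pk Pd QN → (𝟙 :- a :* Pd) :* Pk :* a :* QN :+ (𝟙 :- a :* Pk) :* QN
                                 := QN :* (𝟙 :- a :* (Pk :* (Pd :* a)))) refl q (pow q k) (pow q d) (qfac N) ⟩
    qfac N * (1# - q * (pow q k * (pow q d * q)))  ≈⟨ *-congˡ (+-congˡ (-‿cong (*-congˡ (pow-+ q k (suc d))))) ⟨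
    qfac N * (1# - q * pow q N)                    ∎
    where
    N = k +ℕ suc d
    X = gauss N (suc k)
    Y = gauss N k
    X-identity : X * (qfac (suc k) * qfac d) ≈ qfac N
    X-identity = ≡.subst (λ M → gauss M (suc k) * (qfac (suc k) * qfac d) ≈ qfac M)
                         (≡.sym (ℕP.+-suc k d)) (gauss-qfac (suc k) d)

  gauss-pascal-sum : ∀ n (φ : ℕ → Carrier) →
    Σ≤ n (λ k → gauss n k * (pow q k * φ k + φ (suc k))) ≈ Σ≤ (suc n) (λ k → gauss (suc n) k * φ k)
  gauss-pascal-sum n φ = trans (Σ≤-cong n (λ k _ → distribute k))
      (Σ≤-recombine n A B (λ k → gauss (suc n) k * φ k) first next overhang)
    where
    A B : ℕ → Carrier
    A k = pow q k * (gauss n k * φ k)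
    B k = gauss n k * φ (suc k)
    distribute : ∀ k → gauss n k * (pow q k * φ k + φ (suc k)) ≈ A k + B k
    distribute k = solve 4 (λ G P u v → G :* (P :* u :+ v) := P :* (G :* u) :+ G :* v) refl _ _ _ _
    first : 1# * φ 0 ≈ 1# * (gauss n 0 * φ 0)
    first = trans (*-congʳ (sym (gauss-0 n))) (sym (*-identityˡ _))
    next : ∀ k → gauss (suc n) (suc k) * φ (suc k) ≈ A (suc k) + B k
    next k = solve 4 (λ P G₁ G₀ u → (P :* G₁ :+ G₀) :* u := P :* (G₁ :* u) :+ G₀ :* u) refl _ _ _ _
    overhang : A (suc n) ≈ 0#
    overhang = trans (*-congˡ (*-congʳ (gauss-above n (suc n) ℕP.≤-refl)))
      (solve 2 (λ P u → P :* (𝟘 :* u) := 𝟘) refl _ _)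

  upTerm : Carrier → ℕ → ℕ → Carrier
  upTerm b m k = pow q (2 *ℕ (k C 2)) * pow b k * trunc (b * pow q k) k m

  -- replacing b by bq splits each summand according to the q-Pascal rule
  up-step : ∀ b m k → upTerm (b * q) m k ≈ pow q k * upTerm b m k + upTerm b m (suc k)
  up-step b m k = begin
    E * pow (b * q) k * trunc ((b * q) * P) k m
      ≈⟨ *-cong (*-congˡ (pow-* b q k)) (trunc-cong k m (solve 3 (λ b q P → (b :* q) :* P := (b :* P) :* q) refl b q P)) ⟩
    E * (pow b k * P) * trunc (b * P * q) k m
      ≈⟨ *-congˡ (trunc-step (b * P) k m) ⟩
    E * (pow b k * P) * (trunc (b * P) k m + b * P * trunc (b * P * q) (suc k) m)
      ≈⟨ solve 6 (λ E bk P T₀ b T₁ → E :* (bk :* P) :* (T₀ :+ b :* P :* T₁)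
                                    := P :* (E :* bk :* T₀) :+ P :* (P :* E) :* (bk :* b) :* T₁)
               refl E (pow b k) P (trunc (b * P) k m) b _ ⟩
    P * upTerm b m k + P * (P * E) * pow b (suc k) * trunc (b * P * q) (suc k) m
      ≈⟨ +-congˡ (*-cong (*-congʳ (sym exponent)) (trunc-cong (suc k) m (*-assoc b P q))) ⟩
    P * upTerm b m k + upTerm b m (suc k) ∎
    where
    E = pow q (2 *ℕ (k C 2))
    P = pow q k
    exponent : pow q (2 *ℕ (suc k C 2)) ≈ P * (P * E)
    exponent = begin
      pow q (2 *ℕ (suc k C 2))             ≡⟨ ≡.cong (pow q) (double-C2-suc k) ⟩
      pow q (k +ℕ (k +ℕ 2 *ℕ (k C 2)))     ≈⟨ pow-+ q k _ ⟩
      P * pow q (k +ℕ 2 *ℕ (k C 2))        ≈⟨ *-congˡ (pow-+ q k _) ⟩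
      P * (P * E)                          ∎

  expand-up : ∀ n b y m → y ≈ b * pow q n → poch q y m ≈ Σ≤ n (λ k → gauss n k * upTerm b m k)
  expand-up zero b y m y≈bqⁿ =
    trans (poch-cong m y≈bqⁿ) (solve 1 (λ x → x := 𝟙 :* (𝟙 :* 𝟙 :* x)) refl _)
  expand-up (suc n) b y m y≈bqⁿ = begin
    poch q y m                                                   ≈⟨ expand-up n (b * q) y m y≈bq·qⁿ ⟩
    Σ≤ n (λ k → gauss n k * upTerm (b * q) m k)                  ≈⟨ Σ≤-cong n (λ k _ → *-congˡ (up-step b m k)) ⟩
    Σ≤ n (λ k → gauss n k * (pow q k * upTerm b m k + upTerm b m (suc k)))  ≈⟨ gauss-pascal-sum n (upTerm b m) ⟩
    Σ≤ (suc n) (λ k → gauss (suc n) k * upTerm b m k)            ∎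
    where
    y≈bq·qⁿ : y ≈ b * q * pow q n
    y≈bq·qⁿ = trans y≈bqⁿ (solve 3 (λ b P q → b :* (P :* q) := b :* q :* P) refl b _ q)

  downTerm : Carrier → Carrier → ℕ → ℕ → ℕ → Carrier
  downTerm x y j m k = pow q (k C 2) * pow (- x) k * trunc y (j +ℕ k) m

  -- replacing x by xq (and keeping y) splits each summand by the q-Pascal rule
  down-step : ∀ x y j m k →
    downTerm (x * q) y j m k + (- x) * downTerm (x * q) y (suc j) m k
      ≈ pow q k * downTerm x y j m k + downTerm x y j m (suc k)
  down-step x y j m k = begin
    Cₖ * pow (- (x * q)) k * T₀ + (- x) * (Cₖ * pow (- (x * q)) k * T₁)
      ≈⟨ +-cong (*-congʳ (*-congˡ sign)) (*-congˡ (*-congʳ (*-congˡ sign))) ⟩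
    Cₖ * (pow (- x) k * P) * T₀ + (- x) * (Cₖ * (pow (- x) k * P) * T₁)
      ≈⟨ solve 6 (λ C nxk P T₀ nx T₁ → C :* (nxk :* P) :* T₀ :+ nx :* (C :* (nxk :* P) :* T₁)
                                     := P :* (C :* nxk :* T₀) :+ P :* C :* (nxk :* nx) :* T₁)
               refl Cₖ (pow (- x) k) P T₀ (- x) T₁ ⟩
    P * downTerm x y j m k + P * Cₖ * pow (- x) (suc k) * T₁
      ≈⟨ +-congˡ (*-cong (*-congʳ exponent) (≡.subst (λ t → T₁ ≈ trunc y t m) (≡.sym (ℕP.+-suc j k)) refl)) ⟩
    P * downTerm x y j m k + downTerm x y j m (suc k) ∎
    where
    Cₖ = pow q (k C 2)
    P = pow q k
    T₀ = trunc y (j +ℕ k) m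
    T₁ = trunc y (suc (j +ℕ k)) m
    sign : pow (- (x * q)) k ≈ pow (- x) k * P
    sign = trans (pow-cong k (solve 2 (λ x q → :- (x :* q) := (:- x) :* q) refl x q)) (pow-* (- x) q k)
    exponent : P * Cₖ ≈ pow q (suc k C 2)
    exponent = trans (sym (pow-+ q k (k C 2))) (≡.subst (λ t → pow q (k +ℕ k C 2) ≈ pow q t) (≡.sym (C2-suc k)) refl)

  expand-down : ∀ n x y j m → y ≈ x * pow q n →
    trunc x j m ≈ Σ≤ n (λ k → gauss n k * downTerm x y j m k)
  expand-down zero x y j m y≈xqⁿ = begin
    trunc x j m               ≈⟨ trunc-cong j m (trans (sym (*-identityʳ x)) (sym y≈xqⁿ)) ⟩
    trunc y j m               ≡⟨ ≡.cong (λ t → trunc y t m) (ℕP.+-identityʳ j) ⟨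
    trunc y (j +ℕ 0) m        ≈⟨ solve 1 (λ t → t := 𝟙 :* (𝟙 :* 𝟙 :* t)) refl _ ⟩
    1# * downTerm x y j m 0   ∎
  expand-down (suc n) x y j m y≈xqⁿ = begin
    trunc x j m
      ≈⟨ solve 3 (λ a x b → a := (a :+ x :* b) :+ (:- x) :* b) refl _ x _ ⟩
    (trunc x j m + x * trunc (x * q) (suc j) m) + (- x) * trunc (x * q) (suc j) m
      ≈⟨ +-congʳ (trunc-step x j m) ⟨
    trunc (x * q) j m + (- x) * trunc (x * q) (suc j) m
      ≈⟨ +-cong (expand-down n (x * q) y j m y≈xq·qⁿ) (*-congˡ (expand-down n (x * q) y (suc j) m y≈xq·qⁿ)) ⟩
    Σ≤ n (λ k → gauss n k * D₀ k) + (- x) * Σ≤ n (λ k → gauss n k * D₁ k)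
      ≈⟨ +-congˡ (Σ≤-*ˡ n (- x) _) ⟩
    Σ≤ n (λ k → gauss n k * D₀ k) + Σ≤ n (λ k → (- x) * (gauss n k * D₁ k))
      ≈⟨ Σ≤-+ n _ _ ⟨
    Σ≤ n (λ k → gauss n k * D₀ k + (- x) * (gauss n k * D₁ k))
      ≈⟨ Σ≤-cong n (λ k _ → trans (factor k) (*-congˡ (down-step x y j m k))) ⟩
    Σ≤ n (λ k → gauss n k * (pow q k * downTerm x y j m k + downTerm x y j m (suc k)))
      ≈⟨ gauss-pascal-sum n (downTerm x y j m) ⟩
    Σ≤ (suc n) (λ k → gauss (suc n) k * downTerm x y j m k) ∎
    where
    D₀ D₁ : ℕ → Carrier
    D₀ = downTerm (x * q) y j m
    D₁ = downTerm (x * q) y (suc j) m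
    y≈xq·qⁿ : y ≈ x * q * pow q n
    y≈xq·qⁿ = trans y≈xqⁿ (solve 3 (λ x P q → x :* (P :* q) := x :* q :* P) refl x _ q)
    factor : ∀ k → gauss n k * D₀ k + (- x) * (gauss n k * D₁ k) ≈ gauss n k * (D₀ k + (- x) * D₁ k)
    factor k = solve 4 (λ G u nx v → G :* u :+ nx :* (G :* v) := G :* (u :+ nx :* v)) refl _ _ _ _

  invˡ : ∀ {x} → ¬ (x ≈ 0#) → inv x * x ≈ 1#
  invˡ {x} x≉0 = trans (*-comm _ _) (inverseʳ x x≉0)

  *-≉0 : ∀ {x y} → ¬ (x ≈ 0#) → ¬ (y ≈ 0#) → ¬ (x * y ≈ 0#)
  *-≉0 {x} {y} x≉0 y≉0 xy≈0 = y≉0 (begin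
    y                ≈⟨ *-identityˡ y ⟨
    1# * y           ≈⟨ *-congʳ (invˡ x≉0) ⟨
    inv x * x * y    ≈⟨ *-assoc _ _ _ ⟩
    inv x * (x * y)  ≈⟨ *-congˡ xy≈0 ⟩
    inv x * 0#       ≈⟨ zeroʳ _ ⟩
    0#               ∎)

  *-≉0ʳ : ∀ {x y} → ¬ (x * y ≈ 0#) → ¬ (y ≈ 0#)
  *-≉0ʳ {x} xy≉0 y≈0 = xy≉0 (trans (*-congˡ y≈0) (zeroʳ x))

  ÷-*-cancel : ∀ {w} x → ¬ (w ≈ 0#) → x ÷ w * w ≈ x
  ÷-*-cancel {w} x w≉0 = trans (*-assoc _ _ _) (trans (*-congˡ (invˡ w≉0)) (*-identityʳ x))

  *-÷-cancel : ∀ {w} x → ¬ (w ≈ 0#) → (x * w) ÷ w ≈ x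
  *-÷-cancel {w} x w≉0 = trans (*-assoc _ _ _) (trans (*-congˡ (inverseʳ w w≉0)) (*-identityʳ x))

  *-cancelʳ : ∀ {w x y} → ¬ (w ≈ 0#) → x * w ≈ y * w → x ≈ y
  *-cancelʳ {w} {x} {y} w≉0 xw≈yw = begin
    x            ≈⟨ *-÷-cancel x w≉0 ⟨
    (x * w) ÷ w  ≈⟨ *-congʳ xw≈yw ⟩
    (y * w) ÷ w  ≈⟨ *-÷-cancel y w≉0 ⟩
    y            ∎

  qbinom≈gauss : (∀ N → ¬ (qfac N ≈ 0#)) → ∀ n k → k ≤ n → qbinom q n k ≈ gauss n k
  qbinom≈gauss qfac≉0 n k k≤n = begin
    qfac n ÷ W                    ≡⟨ ≡.cong (λ t → qfac t ÷ W) (ℕP.m+[n∸m]≡n k≤n) ⟨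
    qfac (k +ℕ d) ÷ W             ≈⟨ *-congʳ (gauss-qfac k d) ⟨
    (gauss (k +ℕ d) k * W) ÷ W    ≈⟨ *-÷-cancel _ (*-≉0 (qfac≉0 k) (qfac≉0 d)) ⟩
    gauss (k +ℕ d) k              ≡⟨ ≡.cong (λ t → gauss t k) (ℕP.m+[n∸m]≡n k≤n) ⟩
    gauss n k                     ∎
    where
    d = n ∸ k
    W = qfac k * qfac d

  poch-up-expansion : (∀ N → ¬ (qfac N ≈ 0#)) → ∀ n b m →
    poch q (b * pow q n) m
      ≈ Σ≤ n (λ k → qbinom q n k * pow q (2 *ℕ (k C 2)) * pow b k * trunc (b * pow q k) k m)
  poch-up-expansion qfac≉0 n b m = trans (expand-up n b (b * pow q n) m refl) (Σ≤-cong n coefficient)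
    where
    coefficient : ∀ k → k ≤ n → gauss n k * upTerm b m k
      ≈ qbinom q n k * pow q (2 *ℕ (k C 2)) * pow b k * trunc (b * pow q k) k m
    coefficient k k≤n = trans (*-congʳ (sym (qbinom≈gauss qfac≉0 n k k≤n)))
      (solve 4 (λ G E B T → G :* (E :* B :* T) := G :* E :* B :* T) refl _ _ _ _)

  unshift : ¬ (q ≈ 0#) → ∀ b n → b * pow (inv q) n * pow q n ≈ b
  unshift q≉0 b n = begin
    b * pow (inv q) n * pow q n    ≈⟨ *-assoc _ _ _ ⟩
    b * (pow (inv q) n * pow q n)  ≈⟨ *-congˡ (pow-* (inv q) q n) ⟨
    b * pow (inv q * q) n          ≈⟨ *-congˡ (trans (pow-cong n (invˡ q≉0)) (pow-1 n)) ⟩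
    b * 1#                         ≈⟨ *-identityʳ b ⟩
    b                              ∎

  poch-down-expansion : (∀ N → ¬ (qfac N ≈ 0#)) → ¬ (q ≈ 0#) → ∀ n b m →
    poch q (b * pow (inv q) n) m
      ≈ Σ≤ n (λ k → qbinom q n k * (pow q (k C 2) * pow (inv q) (n *ℕ k)) * pow (- b) k * trunc b k m)
  poch-down-expansion qfac≉0 q≉0 n b m =
    trans (expand-down n x b 0 m (sym (unshift q≉0 b n))) (Σ≤-cong n coefficient)
    where
    x = b * pow (inv q) n
    sign : ∀ k → pow (- x) k ≈ pow (- b) k * pow (inv q) (n *ℕ k)
    sign k = begin
      pow (- x) k                           ≈⟨ pow-cong k (solve 2 (λ b r → :- (b :* r) := (:- b) :* r) refl b _) ⟩
      pow (- b * pow (inv q) n) k           ≈⟨ pow-* (- b) _ k ⟩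
      pow (- b) k * pow (pow (inv q) n) k   ≈⟨ *-congˡ (pow-pow (inv q) n k) ⟨
      pow (- b) k * pow (inv q) (n *ℕ k)    ∎
    coefficient : ∀ k → k ≤ n → gauss n k * downTerm x b 0 m k
      ≈ qbinom q n k * (pow q (k C 2) * pow (inv q) (n *ℕ k)) * pow (- b) k * trunc b k m
    coefficient k k≤n = trans (*-cong (sym (qbinom≈gauss qfac≉0 n k k≤n)) (*-congʳ (*-congˡ (sign k))))
      (solve 5 (λ G E B R T → G :* (E :* (B :* R) :* T) := G :* (E :* R) :* B :* T) refl _ _ _ _ _)

  denom : Carrier → ℕ → ℕ → Carrier
  denom γ m p = qfac m * qfac p * poch q γ (m +ℕ p)

  -- (γq^k;q)_N divides (γ;q)_{k+N}, so it is nonzero with it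
  poch-shift-≉0 : ∀ {γ} → (∀ N → ¬ (poch q γ N ≈ 0#)) → ∀ k N → ¬ (poch q (γ * pow q k) N ≈ 0#)
  poch-shift-≉0 {γ} γ≉0 k N = *-≉0ʳ (λ e → γ≉0 (k +ℕ N) (trans (poch-+ γ k N) e))

  denom-≉0 : ∀ {γ} → (∀ N → ¬ (qfac N ≈ 0#)) → (∀ N → ¬ (poch q γ N ≈ 0#)) →
    ∀ m p → ¬ (denom γ m p ≈ 0#)
  denom-≉0 qfac≉0 γ≉0 m p = *-≉0 (*-≉0 (qfac≉0 m) (qfac≉0 p)) (γ≉0 (m +ℕ p))

  denom-split : ∀ γ k j p →
    denom γ (k +ℕ j) p ≈ (poch q (q * pow q j) k * poch q γ k) * denom (γ * pow q k) j p
  denom-split γ k j p = begin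
    qfac (k +ℕ j) * qfac p * poch q γ (k +ℕ j +ℕ p)
      ≈⟨ *-cong (*-congʳ (qfac-+ k j)) γ-split ⟩
    qfac j * Δ * qfac p * (poch q γ k * poch q (γ * pow q k) (j +ℕ p))
      ≈⟨ solve 5 (λ Qj D Qp G G′ → Qj :* D :* Qp :* (G :* G′) := (D :* G) :* (Qj :* Qp :* G′)) refl _ _ _ _ _ ⟩
    (Δ * poch q γ k) * denom (γ * pow q k) j p ∎
    where
    Δ = poch q (q * pow q j) k
    γ-split : poch q γ (k +ℕ j +ℕ p) ≈ poch q γ k * poch q (γ * pow q k) (j +ℕ p)
    γ-split = ≡.subst (λ t → poch q γ t ≈ poch q γ k * poch q (γ * pow q k) (j +ℕ p))
                      (≡.sym (ℕP.+-assoc k j p)) (poch-+ γ k (j +ℕ p))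

  Φ3-cleared : ∀ a a' β b' γ m p → ¬ (denom γ m p ≈ 0#) →
    Φ3 q a a' β b' γ m p * denom γ m p ≈ poch q a m * poch q a' p * poch q β m * poch q b' p
  Φ3-cleared a a' β b' γ m p = ÷-*-cancel _

  mulXPow-below : ∀ k (s : Series) m p → m < k → mulXPow k s m p ≡ 0#
  mulXPow-below (suc k) s zero    p m<k       = ≡.refl
  mulXPow-below (suc k) s (suc m) p (s≤s m<k) = mulXPow-below k s m p m<k

  mulXPow-above : ∀ k j (s : Series) p → mulXPow k s (k +ℕ j) p ≡ s j p
  mulXPow-above zero    j s p = ≡.refl
  mulXPow-above (suc k) j s p = mulXPow-above k j s p

  module Expansion (qfac≉0 : ∀ N → ¬ (qfac N ≈ 0#)) (a a' b' γ : Carrier)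
                   (γ≉0 : ∀ N → ¬ (poch q γ N ≈ 0#)) where

    -- the β-independent part of the numerator of the (m,p) coefficient
    numer : ℕ → ℕ → Carrier
    numer m p = poch q a m * poch q a' p * poch q b' p

    summand-cleared : ∀ R B β k m p →
      R * (B * (poch q a k ÷ poch q γ k)) * mulXPow k (Φ3 q (a * pow q k) a' β b' (γ * pow q k)) m p
        * denom γ m p
      ≈ numer m p * (R * B * trunc β k m)
    summand-cleared R B β k m p with split k m
    ... | below m<k = begin
      S * mulXPow k s m p * denom γ m p  ≡⟨ ≡.cong (λ t → S * t * denom γ m p) (mulXPow-below k s m p m<k) ⟩
      S * 0# * denom γ m p               ≈⟨ solve 3 (λ S D N → S :* 𝟘 :* D := N :* 𝟘) refl _ _ (numer m p * (R * B)) ⟩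
      numer m p * (R * B) * 0#           ≈⟨ *-congˡ (trunc-below β k m m<k) ⟨
      numer m p * (R * B) * trunc β k m  ≈⟨ *-assoc _ _ _ ⟩
      numer m p * (R * B * trunc β k m)  ∎
      where
      S = R * (B * (poch q a k ÷ poch q γ k))
      s = Φ3 q (a * pow q k) a' β b' (γ * pow q k)
    ... | above j = begin
      S * mulXPow k s (k +ℕ j) p * denom γ (k +ℕ j) p
        ≡⟨ ≡.cong (λ t → S * t * denom γ (k +ℕ j) p) (mulXPow-above k j s p) ⟩
      S * s j p * denom γ (k +ℕ j) p
        ≈⟨ *-congˡ (denom-split γ k j p) ⟩
      S * s j p * ((Δ * Gₖ) * D′)
        ≈⟨ solve 8 (λ R B A iG s D G D′ → R :* (B :* (A :* iG)) :* s :* ((D :* G) :* D′)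
                                         := R :* B :* A :* D :* (iG :* G) :* (s :* D′))
                 refl R B Aₖ (inv Gₖ) (s j p) Δ Gₖ D′ ⟩
      R * B * Aₖ * Δ * (inv Gₖ * Gₖ) * (s j p * D′)
        ≈⟨ *-cong (*-congˡ (invˡ (γ≉0 k))) (Φ3-cleared (a * pow q k) a' β b' (γ * pow q k) j p D′≉0) ⟩
      R * B * Aₖ * Δ * 1# * (poch q (a * pow q k) j * poch q a' p * poch q β j * poch q b' p)
        ≈⟨ solve 8 (λ R B A D A′ a′ β b′ → R :* B :* A :* D :* 𝟙 :* (A′ :* a′ :* β :* b′)
                                          := (A :* A′) :* a′ :* b′ :* (R :* B :* (β :* D)))
                 refl R B Aₖ Δ _ _ _ _ ⟩
      (Aₖ * poch q (a * pow q k) j) * poch q a' p * poch q b' p * (R * B * (poch q β j * Δ))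
        ≈⟨ *-cong (*-congʳ (*-congʳ (poch-+ a k j))) (*-congˡ (trunc-above β k j)) ⟨
      numer (k +ℕ j) p * (R * B * trunc β k (k +ℕ j)) ∎
      where
      S = R * (B * (poch q a k ÷ poch q γ k))
      s = Φ3 q (a * pow q k) a' β b' (γ * pow q k)
      Aₖ = poch q a k
      Gₖ = poch q γ k
      Δ = poch q (q * pow q j) k
      D′ = denom (γ * pow q k) j p
      D′≉0 : ¬ (D′ ≈ 0#)
      D′≉0 = denom-≉0 qfac≉0 (poch-shift-≉0 γ≉0 k) j p

    Φ3-expand : ∀ n β (βₖ R B : ℕ → Carrier) →
      (∀ m → poch q β m ≈ Σ≤ n (λ k → R k * B k * trunc (βₖ k) k m)) →
      Φ3 q a a' β b' γ
        ≋ sumTo n (λ k → scale (R k * (B k * (poch q a k ÷ poch q γ k)))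
                               (mulXPow k (Φ3 q (a * pow q k) a' (βₖ k) b' (γ * pow q k))))
    Φ3-expand n β βₖ R B expansion m p = *-cancelʳ D≉0 (begin
      Φ3 q a a' β b' γ m p * D                                   ≈⟨ Φ3-cleared a a' β b' γ m p D≉0 ⟩
      poch q a m * poch q a' p * poch q β m * poch q b' p
        ≈⟨ solve 4 (λ A a′ β b′ → A :* a′ :* β :* b′ := A :* a′ :* b′ :* β) refl _ _ _ _ ⟩
      numer m p * poch q β m                                     ≈⟨ *-congˡ (expansion m) ⟩
      numer m p * Σ≤ n (λ k → R k * B k * trunc (βₖ k) k m)      ≈⟨ Σ≤-*ˡ n _ _ ⟩
      Σ≤ n (λ k → numer m p * (R k * B k * trunc (βₖ k) k m))    ≈⟨ Σ≤-cong n (λ k _ → summand-cleared (R k) (B k) (βₖ k) k m p) ⟨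
      Σ≤ n (λ k → f k m p * D)                                   ≈⟨ Σ≤-*ʳ n _ _ ⟨
      Σ≤ n (λ k → f k m p) * D                                   ≡⟨ ≡.cong (_* D) (sumTo-Σ≤ n f m p) ⟨
      sumTo n f m p * D                                          ∎)
      where
      D = denom γ m p
      D≉0 = denom-≉0 qfac≉0 γ≉0 m p
      f : ℕ → Series
      f k = scale (R k * (B k * (poch q a k ÷ poch q γ k)))
                  (mulXPow k (Φ3 q (a * pow q k) a' (βₖ k) b' (γ * pow q k)))

theorem12 : ∀ {c ℓ : Level} (F : Field c ℓ) →
    let open Field F
        open FieldDefs F
    in (q a a' b b' γ : Carrier) →
       (∀ N → ¬ (poch q q N ≈ 0#)) →
       (∀ N → ¬ (poch q γ N ≈ 0#)) →
       (n : ℕ) → 1 ≤ n →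
       (Φ3 q a a' (b * pow q n) b' γ
          ≋ sumTo n (λ k → scale (qbinom q n k * pow q (2 *ℕ (k C 2))
                                   * (pow b k * poch q a k ÷ poch q γ k))
                               (mulXPow k (Φ3 q (a * pow q k) a' (b * pow q k) b' (γ * pow q k)))))
       × (¬ (q ≈ 0#) →
          Φ3 q a a' (b * pow (inv q) n) b' γ
          ≋ sumTo n (λ k → scale (qbinom q n k * (pow q (k C 2) * pow (inv q) (n *ℕ k))
                                   * (pow (- b) k * poch q a k ÷ poch q γ k))
                               (mulXPow k (Φ3 q (a * pow q k) a' b b' (γ * pow q k)))))
theorem12 F q a a' b b' γ qfac≉0 γ≉0 n _ =
  Φ3-expand n (b * pow q n) (λ k → b * pow q k)
            (λ k → qbinom q n k * pow q (2 *ℕ (k C 2))) (pow b)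
            (poch-up-expansion qfac≉0 n b)
  , λ q≉0 → Φ3-expand n (b * pow (inv q) n) (λ _ → b)
                      (λ k → qbinom q n k * (pow q (k C 2) * pow (inv q) (n *ℕ k))) (pow (- b))
                      (poch-down-expansion qfac≉0 q≉0 n b)
  where
  open Field F using (_*_; -_; inv)
  open FieldDefs F using (pow; qbinom)
  open QCalculus F q
  open Expansion qfac≉0 a a' b' γ γ≉0
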